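{- Let $r\geq 3$ be an integer and let $G$ be a (finite, simple) bipartite graph such that $r$ divides $d(v)$ for every vertex $v\in V(G)$. Then every double-star of size $r$ decomposes $G$.
   Context: $d(v)$ is the degree of $v$. A double-star is a tree with exactly two non-pendant vertices (a pendant vertex being a vertex of degree $1$); the size of a graph is its number of edges. A graph $H$ decomposes $G$ if $E(G)$ can be partitioned into subsets each of which forms a subgraph isomorphic to $H$. -}

module Defs where

open import Data.Nat using (ℕ; zero; suc; _<_; _≤_; _<ᵇ_)
open import Data.Bool using (Bool; true; false; if_then_else_)
open import Data.Fin using (Fin; zero; suc; toℕ; inject₁; fromℕ)
open import Data.List using (List; map; allFin)
open import Data.Nat.ListAction using (sum)
open import Data.Product using (Σ; ∃; ∃-syntax; _×_; _,_)
open import Data.Sum using (_⊎_)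
open import Relation.Nullary using (¬_)
open import Relation.Binary.PropositionalEquality using (_≡_; _≢_)
open import Function.Definitions using (Injective)

record SimpleGraph (n : ℕ) : Set where
  field
    adj    : Fin n → Fin n → Bool
    sym    : ∀ x y → adj x y ≡ adj y x
    irrefl : ∀ x → adj x x ≡ false
open SimpleGraph public

Adj : ∀ {n} → SimpleGraph n → Fin n → Fin n → Set
Adj G x y = adj G x y ≡ true

degree : ∀ {n} → SimpleGraph n → Fin n → ℕ
degree {n} G v = sum (map (λ w → if adj G v w then 1 else 0) (allFin n))

size : ∀ {n} → SimpleGraph n → ℕ
size {n} G = sum (map (λ x → sum (map (λ y → if adj G x y
                                               then (if toℕ x <ᵇ toℕ y then 1 else 0)
                                               else 0) (allFin n))) (allFin n))

Bipartite : ∀ {n} → SimpleGraph n → Set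
Bipartite {n} G = Σ (Fin n → Bool) λ col → ∀ x y → Adj G x y → col x ≢ col y

data Walk {n} (G : SimpleGraph n) : Fin n → Fin n → Set where
  here : ∀ {x} → Walk G x x
  step : ∀ {x y z} → Adj G x y → Walk G y z → Walk G x z

Connected : ∀ {n} → SimpleGraph n → Set
Connected {n} G = ∀ (x y : Fin n) → Walk G x y

Cycle : ∀ {n} → SimpleGraph n → Set
Cycle {n} G = Σ ℕ λ k → Σ (Fin (suc (suc (suc k))) → Fin n) λ c →
  Injective _≡_ _≡_ c ×
  (∀ (i : Fin (suc (suc k))) → Adj G (c (inject₁ i)) (c (suc i))) ×
  Adj G (c (fromℕ (suc (suc k)))) (c zero)

Acyclic : ∀ {n} → SimpleGraph n → Set
Acyclic G = ¬ Cycle G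

IsTree : ∀ {n} → SimpleGraph n → Set
IsTree G = Connected G × Acyclic G

Pendant : ∀ {n} → SimpleGraph n → Fin n → Set
Pendant G v = degree G v ≡ 1

IsDoubleStar : ∀ {n} → SimpleGraph n → Set
IsDoubleStar {n} G = IsTree G × Σ (Fin n) λ u → Σ (Fin n) λ v →
  u ≢ v × ¬ Pendant G u × ¬ Pendant G v ×
  (∀ w → ¬ Pendant G w → (w ≡ u ⊎ w ≡ v))

-- H decomposes G: a finite family of copies of H in G (injective
-- homomorphisms φ i : V(H) → V(G)) such that every edge of G lies in the
-- image of exactly one copy.  (Within one copy, injectivity makes the
-- preimage edge unique.)
EdgeIn : ∀ {m n} → SimpleGraph m → (Fin m → Fin n) → Fin n → Fin n → Set
EdgeIn H φ x y = Σ _ λ a → Σ _ λ b → Adj H a b × φ a ≡ x × φ b ≡ y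

Decomposes : ∀ {m n} → SimpleGraph m → SimpleGraph n → Set
Decomposes {m} {n} H G = Σ ℕ λ k → Σ (Fin k → Fin m → Fin n) λ φ →
  (∀ i → Injective _≡_ _≡_ (φ i)) ×
  (∀ i a b → Adj H a b → Adj G (φ i a) (φ i b)) ×
  (∀ x y → Adj G x y →
     Σ (Fin k) λ i → EdgeIn H (φ i) x y × (∀ j → EdgeIn H (φ j) x y → j ≡ i))

-- Let u and v be the centres of the double star H, with a further neighbours of u and b of v, so
-- that r = 1 + a + b. Split every vertex x of G into d(x)/r vertices, each receiving r consecutive
-- neighbours of x. The resulting bipartite multigraph is r-regular, so by Kőnig's edge-colouring
-- theorem (proved here with Kempe chains) it has a proper r-edge-colouring, in which every split
-- vertex sees each colour exactly once. Reserve colour 0 for central edges, colours 1..a for the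
-- leaves at u and colours a+1..a+b for those at v. Each edge xy of colour 0, with x in the first
-- colour class of G, is the central edge of a copy of H: its leaves at x are the far ends of the
-- edges of colours 1..a in the block of x containing xy, its leaves at y those of the edges of
-- colours a+1..a+b in the block of y containing xy. An edge of colour 1..a lies exactly in the copy
-- of the colour-0 edge of its first block, an edge of colour a+1..a+b exactly in the copy of the
-- colour-0 edge of its second block.

module Submission where

open import Defs hiding (sym; irrefl)
open import Data.Nat.Properties
  using (+-0-commutativeMonoid; <-irrefl; <-cmp; n<1+n; ≤-refl; ≤-trans; n≤1+n; ≤-pred; ≮⇒≥; ≤⇒≤′;
         m≤n⇒m<n∨m≡n; <-≤-trans;
         +-comm; +-identityʳ; +-monoʳ-<; +-monoˡ-<; +-cancelʳ-≡; *-monoˡ-≤; *-cancelˡ-≡)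
open import Algebra.Properties.CommutativeMonoid.Sum +-0-commutativeMonoid
  using (sum; sum-replicate-zero; ∑-distrib-+; ∑-comm; sum-cong-≗)
open import Data.Bool using (Bool; true; false; _∧_; not; if_then_else_)
open import Data.Bool.Properties using (¬-not)
open import Data.Empty using (⊥; ⊥-elim)
open import Data.Fin using (Fin; zero; suc; toℕ; fromℕ<; punchOut; combine; remQuot; _↑ˡ_; _↑ʳ_; splitAt; join; _≟_)
open import Data.Fin.Permutation using (transpose; _⟨$⟩ʳ_; _⟨$⟩ˡ_; inverseˡ)
open import Data.Fin.Properties
  using (toℕ-injective; toℕ-fromℕ<; toℕ<n; pigeonhole; any?; punchOut-injective; remQuot-combine; combine-remQuot;
         splitAt-↑ˡ; splitAt-↑ʳ; join-splitAt; ↑ˡ-injective; ↑ʳ-injective; suc-injective)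
open import Data.List using (map; allFin; tabulate)
open import Data.List.Properties using (map-tabulate)
open import Data.Maybe using (Maybe; just; nothing; fromMaybe)
import Data.Maybe as Maybe
open import Data.Nat
  using (ℕ; zero; suc; _+_; _*_; _/_; _<_; _≤_; z≤n; s≤s; _<?_; _<ᵇ_; _≤′_; ≤′-refl; ≤′-step)
import Data.Nat as ℕ
open import Data.Nat.DivMod using (_mod_; _%_; m≡m%n+[m/n]*n; m<n*o⇒m/o<n; +-distrib-/-∣ʳ; m<n⇒m/n≡0; m*n/n≡m)
open import Data.Nat.Divisibility using (_∣_; n∣m*n)
open import Data.Nat.ListAction using () renaming (sum to listSum)
open import Data.Nat.Tactic.RingSolver using (solve-∀)
open import Data.Product using (Σ; _×_; _,_; proj₁; proj₂)
open import Data.Product.Properties using (≡-dec)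
open import Data.Sum using (_⊎_; inj₁; inj₂)
open import Function using (_∘_; id)
open import Function.Definitions using (Injective; Surjective)
open import Relation.Binary.Definitions using (DecidableEquality; tri<; tri≈; tri>)
open import Relation.Binary.PropositionalEquality
open import Relation.Nullary using (¬_; Dec; yes; no; does; _×-dec_; ¬?)
open import Relation.Nullary.Decidable using (dec-true; dec-false)

-- Counting in Fin n

𝟙 : Bool → ℕ
𝟙 b = if b then 1 else 0

count : ∀ {n} → (Fin n → Bool) → ℕ
count p = sum (𝟙 ∘ p)

sum-tabulate : ∀ {n} (f : Fin n → ℕ) → listSum (tabulate f) ≡ sum f
sum-tabulate {zero}  f = refl
sum-tabulate {suc n} f = cong (f zero +_) (sum-tabulate (f ∘ suc))

sum-allFin : ∀ n (f : Fin n → ℕ) → listSum (map f (allFin n)) ≡ sum f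
sum-allFin n f = trans (cong listSum (map-tabulate id f)) (sum-tabulate f)

rank : ∀ {n} → (Fin n → Bool) → Fin n → ℕ
rank p zero    = 0
rank p (suc i) = 𝟙 (p zero) + rank (p ∘ suc) i

rank-strictMono : ∀ {n} (p : Fin n → Bool) {i j} → p i ≡ true → toℕ i < toℕ j → rank p i < rank p j
rank-strictMono p {zero}  {suc j} pi _         rewrite pi = s≤s z≤n
rank-strictMono p {suc i} {suc j} pi (s≤s i<j) = +-monoʳ-< (𝟙 (p zero)) (rank-strictMono (p ∘ suc) pi i<j)

rank-injective : ∀ {n} (p : Fin n → Bool) {i j} → p i ≡ true → p j ≡ true → rank p i ≡ rank p j → i ≡ j
rank-injective p {i} {j} pi pj eq with <-cmp (toℕ i) (toℕ j)
... | tri< i<j _ _ = ⊥-elim (<-irrefl eq (rank-strictMono p pi i<j))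
... | tri≈ _ i≡j _ = toℕ-injective i≡j
... | tri> _ _ j<i = ⊥-elim (<-irrefl (sym eq) (rank-strictMono p pj j<i))

rank<count : ∀ {n} (p : Fin n → Bool) {i} → p i ≡ true → rank p i < count p
rank<count p {zero}  pi rewrite pi = s≤s z≤n
rank<count p {suc i} pi = +-monoʳ-< (𝟙 (p zero)) (rank<count (p ∘ suc) pi)

rank-surjective : ∀ {n} (p : Fin n → Bool) t → t < count p → Σ (Fin n) λ i → p i ≡ true × rank p i ≡ t
rank-surjective {suc n} p t t<count with p zero in p0
rank-surjective {suc n} p zero    _             | true = zero , p0 , refl
rank-surjective {suc n} p (suc t) (s≤s t<count) | true with rank-surjective (p ∘ suc) t t<count
... | i , pi , refl = suc i , pi , cong (λ b → 𝟙 b + rank (p ∘ suc) i) p0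
rank-surjective {suc n} p t       t<count       | false with rank-surjective (p ∘ suc) t t<count
... | i , pi , refl = suc i , pi , cong (λ b → 𝟙 b + rank (p ∘ suc) i) p0

module Enumeration {n} (p : Fin n → Bool) where

  index : ∀ {i} → p i ≡ true → Fin (count p)
  index pi = fromℕ< (rank<count p pi)

  private
    surj : (t : Fin (count p)) → Σ (Fin n) λ i → p i ≡ true × rank p i ≡ toℕ t
    surj t = rank-surjective p (toℕ t) (toℕ<n t)

  element : Fin (count p) → Fin n
  element t = proj₁ (surj t)

  element-sat : ∀ t → p (element t) ≡ true
  element-sat t = proj₁ (proj₂ (surj t))

  rank-element : ∀ t → rank p (element t) ≡ toℕ t
  rank-element t = proj₂ (proj₂ (surj t))

  element-index : ∀ {i} (pi : p i ≡ true) → element (index pi) ≡ i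
  element-index pi = rank-injective p (element-sat _) pi (trans (rank-element _) (toℕ-fromℕ< _))

  element-injective : Injective _≡_ _≡_ element
  element-injective {t} {t'} eq =
    toℕ-injective (trans (sym (rank-element t)) (trans (cong (rank p) eq) (rank-element t')))

  index-element : ∀ t → index (element-sat t) ≡ t
  index-element t = toℕ-injective (trans (toℕ-fromℕ< _) (rank-element t))

  element≡⇒index : ∀ {t i} (pi : p i ≡ true) → element t ≡ i → t ≡ index pi
  element≡⇒index {t} pi refl = sym (index-element t)

count≡1⇒unique : ∀ {n} (p : Fin n → Bool) → count p ≡ 1 → ∀ {i j} → p i ≡ true → p j ≡ true → i ≡ j
count≡1⇒unique p count≡1 pi pj = rank-injective p pi pj (trans (rank≡0 pi) (sym (rank≡0 pj)))
  where
  rank≡0 : ∀ {i} → p i ≡ true → rank p i ≡ 0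
  rank≡0 {i} pi with rank p i | subst (rank p i <_) count≡1 (rank<count p pi)
  ... | zero  | _          = refl
  ... | suc _ | s≤s ()

injective⇒surjective : ∀ {n} {f : Fin n → Fin n} → Injective _≡_ _≡_ f → Surjective _≡_ _≡_ f
injective⇒surjective {suc n} {f} f-injective γ with any? (λ j → f j ≟ γ)
... | yes (j , fj≡γ) = j , λ { refl → fj≡γ }
... | no ∄j =
  let i , j , i<j , eq = pigeonhole (n<1+n n) (λ j → punchOut (avoids j))
  in ⊥-elim (<-irrefl (cong toℕ (f-injective (punchOut-injective (avoids i) (avoids j) eq))) i<j)
  where
  avoids : ∀ j → γ ≢ f j
  avoids j γ≡fj = ∄j (j , sym γ≡fj)

pointMass : ∀ {n} → Fin n → ℕ → Fin n → ℕ
pointMass i c j = if does (j ≟ i) then c else 0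

sum-pointMass : ∀ {n} (i : Fin n) c → sum (pointMass i c) ≡ c
sum-pointMass {suc n} zero c = trans (cong (c +_) (sum-replicate-zero n)) (+-identityʳ c)
sum-pointMass {suc n} (suc i) c = sum-pointMass i c

true≢false : true ≢ false
true≢false ()

adj-sym : ∀ {n} (G : SimpleGraph n) {x y} → Adj G x y → Adj G y x
adj-sym G {x} {y} xy = trans (SimpleGraph.sym G y x) xy

adj-irrefl : ∀ {n} (G : SimpleGraph n) {x} → ¬ Adj G x x
adj-irrefl G {x} xx = true≢false (trans (sym xx) (SimpleGraph.irrefl G x))

degree≡count : ∀ {n} (G : SimpleGraph n) x → degree G x ≡ count (adj G x)
degree≡count {n} G x = sum-allFin n (𝟙 ∘ adj G x)

module _ {n} (G : SimpleGraph n) where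

  private
    below : Fin n → Fin n → ℕ
    below x y = if adj G x y then 𝟙 (toℕ x <ᵇ toℕ y) else 0

    <ᵇ-trichotomy : ∀ i j → i ≢ j → 𝟙 (i <ᵇ j) + 𝟙 (j <ᵇ i) ≡ 1
    <ᵇ-trichotomy zero    zero    i≢j = ⊥-elim (i≢j refl)
    <ᵇ-trichotomy zero    (suc j) _   = refl
    <ᵇ-trichotomy (suc i) zero    _   = refl
    <ᵇ-trichotomy (suc i) (suc j) i≢j = <ᵇ-trichotomy i j (λ i≡j → i≢j (cong suc i≡j))

    below-pair : ∀ x y → below x y + below y x ≡ 𝟙 (adj G x y)
    below-pair x y rewrite SimpleGraph.sym G y x with adj G x y in xy
    ... | false = refl
    ... | true  =
      <ᵇ-trichotomy (toℕ x) (toℕ y) λ x≡y → adj-irrefl G (subst (Adj G x) (sym (toℕ-injective x≡y)) xy)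

  size-handshake : 2 * size G ≡ sum (degree G)
  size-handshake = begin
    2 * size G
      ≡⟨ cong (size G +_) (+-identityʳ (size G)) ⟩
    size G + size G
      ≡⟨ cong₂ _+_ size≡ (trans size≡ (∑-comm below)) ⟩
    sum (λ x → sum (below x)) + sum (λ x → sum (λ y → below y x))
      ≡⟨ sym (∑-distrib-+ (λ x → sum (below x)) (λ x → sum (λ y → below y x))) ⟩
    sum (λ x → sum (below x) + sum (λ y → below y x))
      ≡⟨ sum-cong-≗ (λ x → sym (∑-distrib-+ (below x) (λ y → below y x))) ⟩
    sum (λ x → sum (λ y → below x y + below y x))
      ≡⟨ sum-cong-≗ (λ x → sum-cong-≗ (below-pair x)) ⟩
    sum (λ x → count (adj G x))
      ≡⟨ sum-cong-≗ (λ x → sym (degree≡count G x)) ⟩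
    sum (degree G) ∎
    where
    open ≡-Reasoning
    size≡ : size G ≡ sum (λ x → sum (below x))
    size≡ = trans (sum-allFin n _) (sum-cong-≗ (λ x → sum-allFin n (below x)))

closed-under-walks : ∀ {n} {G : SimpleGraph n} (S : Fin n → Set) → (∀ {x y} → Adj G x y → S x → S y) →
                     ∀ {x y} → Walk G x y → S x → S y
closed-under-walks S closed here       sx = sx
closed-under-walks S closed (step a w) sx = closed-under-walks S closed w (closed a sx)

-- Kőnig's edge-colouring theorem for bipartite multigraphs
-- A bipartite multigraph has edges Fin N and end maps eA, eB into the vertices of its two parts;
-- properness is required at each end map separately, so an A-end never conflicts with a B-end.

AtMost : ∀ {N} {V : Set} → ℕ → (Fin N → V) → Set
AtMost {N} r end = (f : Fin (suc r) → Fin N) → Injective _≡_ _≡_ f → ¬ (∀ i → end (f i) ≡ end (f zero))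

ProperAt : ∀ {N r} {V : Set} → (Fin N → V) → (Fin N → Fin r) → Set
ProperAt end c = ∀ {e e'} → end e ≡ end e' → c e ≡ c e' → e ≡ e'

some-colour : ∀ {N r} {V : Set} {end : Fin N → V} → AtMost r end → Fin N → Fin r
some-colour {r = zero}  atMost e = ⊥-elim (atMost (λ _ → e) (λ { {zero} {zero} _ → refl }) (λ { zero → refl }))
some-colour {r = suc _} _      _ = zero

atMost-byResidue : ∀ {N r} {V : Set} {end : Fin N → V} (residue : Fin N → Fin r) →
                   (∀ {e e'} → end e ≡ end e' → residue e ≡ residue e' → e ≡ e') → AtMost r end
atMost-byResidue {r = r} residue separates f f-injective f-at =
  let i , j , i<j , same-residue = pigeonhole (n<1+n r) (residue ∘ f)
  in <-irrefl (cong toℕ (f-injective (separates (trans (f-at i) (sym (f-at j))) same-residue))) i<j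

every-colour : ∀ {N r} {V : Set} {end : Fin N → V} {c : Fin N → Fin r} → ProperAt end c →
               ∀ {v} (h : Fin r → Fin N) → Injective _≡_ _≡_ h → (∀ j → end (h j) ≡ v) →
               ∀ γ → Σ (Fin N) λ e → end e ≡ v × c e ≡ γ
every-colour {c = c} proper h h-injective h-at γ =
  let j , c∘h≡γ = injective⇒surjective c∘h-injective γ
  in h j , h-at j , c∘h≡γ refl
  where
  c∘h-injective : Injective _≡_ _≡_ (c ∘ h)
  c∘h-injective {i} {j} eq = h-injective (proper (trans (h-at i) (sym (h-at j))) eq)

module _ {N r : ℕ} {V : Set} (_≟ᵥ_ : DecidableEquality V) where

  ProperBelow : ℕ → (Fin N → V) → (Fin N → Fin r) → Set
  ProperBelow k end c = ∀ {e e'} → toℕ e < k → toℕ e' < k → end e ≡ end e' → c e ≡ c e' → e ≡ e'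

  Present : ℕ → (Fin N → V) → (Fin N → Fin r) → V → Fin r → Set
  Present k end c v γ = Σ (Fin N) λ e → toℕ e < k × end e ≡ v × c e ≡ γ

  Missing : ℕ → (Fin N → V) → (Fin N → Fin r) → V → Fin r → Set
  Missing k end c v γ = ∀ {e} → toℕ e < k → end e ≡ v → c e ≢ γ

  present? : ∀ k end c v γ → Dec (Present k end c v γ)
  present? k end c v γ = any? (λ e → (toℕ e <? k) ×-dec (end e ≟ᵥ v) ×-dec (c e ≟ γ))

  missing-colour : ∀ {k end c} → AtMost r end → ProperBelow k end c →
                   ∀ ek → toℕ ek ≡ k → Σ (Fin r) (Missing k end c (end ek))
  missing-colour {k} {end} {c} atMost proper ek refl with any? (λ γ → ¬? (present? k end c (end ek) γ))
  ... | yes (γ , ∄e) = γ , λ e<k e-at eγ → ∄e (_ , e<k , e-at , eγ)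
  ... | no all-present = ⊥-elim (atMost f f-injective f-at)
    where
    witness : ∀ γ → Present k end c (end ek) γ
    witness γ with present? k end c (end ek) γ
    ... | yes p = p
    ... | no ¬p = ⊥-elim (all-present (γ , ¬p))
    f : Fin (suc r) → Fin N
    f zero    = ek
    f (suc γ) = proj₁ (witness γ)
    f-at : ∀ i → end (f i) ≡ end ek
    f-at zero    = refl
    f-at (suc γ) = proj₁ (proj₂ (proj₂ (witness γ)))
    below : ∀ γ → toℕ (f (suc γ)) < toℕ ek
    below γ = proj₁ (proj₂ (witness γ))
    f-injective : Injective _≡_ _≡_ f
    f-injective {zero}  {zero}  _  = refl
    f-injective {zero}  {suc δ} eq = ⊥-elim (<-irrefl (cong toℕ (sym eq)) (below δ))
    f-injective {suc γ} {zero}  eq = ⊥-elim (<-irrefl (cong toℕ eq) (below γ))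
    f-injective {suc γ} {suc δ} eq = cong suc (begin
      γ                     ≡⟨ sym (proj₂ (proj₂ (proj₂ (witness γ)))) ⟩
      c (proj₁ (witness γ)) ≡⟨ cong c eq ⟩
      c (proj₁ (witness δ)) ≡⟨ proj₂ (proj₂ (proj₂ (witness δ))) ⟩
      δ                     ∎)
      where open ≡-Reasoning

  below-suc : ∀ {e ek : Fin N} → toℕ e < suc (toℕ ek) → e ≡ ek ⊎ toℕ e < toℕ ek
  below-suc e≤ek with m≤n⇒m<n∨m≡n (≤-pred e≤ek)
  ... | inj₁ e<ek = inj₂ e<ek
  ... | inj₂ e≡ek = inj₁ (toℕ-injective e≡ek)

  _[_≔_] : (Fin N → Fin r) → Fin N → Fin r → Fin N → Fin r
  (c [ ek ≔ α ]) e with e ≟ ek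
  ... | yes _ = α
  ... | no  _ = c e

  assign-here : ∀ c ek α → (c [ ek ≔ α ]) ek ≡ α
  assign-here c ek α with ek ≟ ek
  ... | yes _     = refl
  ... | no  ek≢ek = ⊥-elim (ek≢ek refl)

  assign-below : ∀ c {ek e} α → toℕ e < toℕ ek → (c [ ek ≔ α ]) e ≡ c e
  assign-below c {ek} {e} α e<ek with e ≟ ek
  ... | yes refl = ⊥-elim (<-irrefl refl e<ek)
  ... | no  _    = refl

  assign-proper : ∀ {end c α} ek → ProperBelow (toℕ ek) end c → Missing (toℕ ek) end c (end ek) α →
                  ProperBelow (suc (toℕ ek)) end (c [ ek ≔ α ])
  assign-proper {end} {c} {α} ek proper missing {e} {e'} e≤ek e'≤ek same-end same-colour
    with below-suc {ek = ek} e≤ek | below-suc {ek = ek} e'≤ek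
  ... | inj₁ refl | inj₁ refl = refl
  ... | inj₁ refl | inj₂ e'<ek =
    ⊥-elim (missing e'<ek (sym same-end)
                    (trans (sym (assign-below c α e'<ek)) (trans (sym same-colour) (assign-here c ek α))))
  ... | inj₂ e<ek | inj₁ refl =
    ⊥-elim (missing e<ek same-end (trans (sym (assign-below c α e<ek)) (trans same-colour (assign-here c ek α))))
  ... | inj₂ e<ek | inj₂ e'<ek =
    proper e<ek e'<ek same-end (trans (sym (assign-below c α e<ek)) (trans same-colour (assign-below c α e'<ek)))

  module KempeChain {k : ℕ} {eA eB : Fin N → V} {c : Fin N → Fin r}
                    (properA : ProperBelow k eA c) (properB : ProperBelow k eB c)
                    {vA vB : V} {α β : Fin r}
                    (α-missing : Missing k eA c vA α) (β-missing : Missing k eB c vB β)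
                    (α-present : Present k eB c vB α) where

    e₀ : Fin N
    e₀ = proj₁ α-present

    e₀<k : toℕ e₀ < k
    e₀<k = proj₁ (proj₂ α-present)

    e₀-at : eB e₀ ≡ vB
    e₀-at = proj₁ (proj₂ (proj₂ α-present))

    e₀-colour : c e₀ ≡ α
    e₀-colour = proj₂ (proj₂ (proj₂ α-present))

    α≢β : α ≢ β
    α≢β α≡β = β-missing e₀<k e₀-at (trans e₀-colour α≡β)

    find : (Fin N → V) → V → Fin r → Maybe (Fin N)
    find end v γ with present? k end c v γ
    ... | yes (e , _) = just e
    ... | no  _       = nothing

    find-sound : ∀ end v γ {e} → find end v γ ≡ just e → toℕ e < k × end e ≡ v × c e ≡ γ
    find-sound end v γ eq with present? k end c v γ
    find-sound end v γ refl | yes (_ , found) = found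

    find-at : ∀ end v γ {e} → find end v γ ≡ just e → end e ≡ v
    find-at end v γ found = proj₁ (proj₂ (find-sound end v γ found))

    find-complete : ∀ {end} → ProperBelow k end c → ∀ {e} → toℕ e < k → find end (end e) (c e) ≡ just e
    find-complete {end} proper {e} e<k with present? k end c (end e) (c e)
    ... | yes (e' , e'<k , same-end , same-colour) = cong just (proper e'<k e<k same-end same-colour)
    ... | no ∄e = ⊥-elim (∄e (e , e<k , refl , refl))

    -- An edge tagged true has colour α and the chain leaves it through its A-end along β;
    -- an edge tagged false has colour β and the chain leaves it through its B-end along α.
    colour : Bool → Fin r
    colour true  = α
    colour false = β

    colour-injective : ∀ {b b'} → colour b ≡ colour b' → b ≡ b'
    colour-injective {true}  {true}  _   = refl
    colour-injective {true}  {false} α≡β = ⊥-elim (α≢β α≡β)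
    colour-injective {false} {true}  β≡α = ⊥-elim (α≢β (sym β≡α))
    colour-injective {false} {false} _   = refl

    next : Bool → Fin N → Maybe (Fin N)
    next true  e = find eA (eA e) β
    next false e = find eB (eB e) α

    advance : Maybe (Bool × Fin N) → Maybe (Bool × Fin N)
    advance nothing        = nothing
    advance (just (b , e)) = Maybe.map (not b ,_) (next b e)

    chain : ℕ → Maybe (Bool × Fin N)
    chain zero    = just (true , e₀)
    chain (suc i) = advance (chain i)

    advance-inverse : ∀ m {b e} → advance m ≡ just (b , e) →
                      Σ (Fin N) λ e₁ → m ≡ just (not b , e₁) × next (not b) e₁ ≡ just e
    advance-inverse (just (true  , e₁)) eq with next true e₁ in found
    advance-inverse (just (true  , e₁)) refl | just _ = e₁ , refl , found
    advance-inverse (just (false , e₁)) eq with next false e₁ in found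
    advance-inverse (just (false , e₁)) refl | just _ = e₁ , refl , found

    chain-coloured : ∀ i {b e} → chain i ≡ just (b , e) → toℕ e < k × c e ≡ colour b
    chain-coloured zero refl = e₀<k , e₀-colour
    chain-coloured (suc i) {true} eq =
      let e₁ , _ , found = advance-inverse (chain i) eq
          e<k , _ , colour≡ = find-sound eB (eB e₁) α found
      in e<k , colour≡
    chain-coloured (suc i) {false} eq =
      let e₁ , _ , found = advance-inverse (chain i) eq
          e<k , _ , colour≡ = find-sound eA (eA e₁) β found
      in e<k , colour≡

    next-injective : ∀ b {e₁ e₂ e} → toℕ e₁ < k → c e₁ ≡ colour b → toℕ e₂ < k → c e₂ ≡ colour b →
                     next b e₁ ≡ just e → next b e₂ ≡ just e → e₁ ≡ e₂
    next-injective true  e₁<k c₁ e₂<k c₂ found₁ found₂ =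
      properA e₁<k e₂<k (trans (sym (find-at eA _ β found₁)) (find-at eA _ β found₂)) (trans c₁ (sym c₂))
    next-injective false e₁<k c₁ e₂<k c₂ found₁ found₂ =
      properB e₁<k e₂<k (trans (sym (find-at eB _ α found₁)) (find-at eB _ α found₂)) (trans c₁ (sym c₂))

    -- An edge of the chain determines its predecessor, and e₀ has none since β is missing at vB.
    chain-no-return : ∀ i j {w} → i < j → chain i ≡ just w → chain j ≡ just w → ⊥
    chain-no-return zero (suc j) _ refl eq =
      let e₁ , prev , found = advance-inverse (chain j) eq
          e₁<k , e₁-colour = chain-coloured j prev
      in β-missing e₁<k (trans (sym (find-at eB _ α found)) e₀-at) e₁-colour
    chain-no-return (suc i) (suc j) {b , e} (s≤s i<j) eqᵢ eqⱼ
      with advance-inverse (chain i) eqᵢ | advance-inverse (chain j) eqⱼ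
    ... | e₁ , prevᵢ , foundᵢ | e₂ , prevⱼ , foundⱼ
      with chain-coloured i prevᵢ | chain-coloured j prevⱼ
    ... | e₁<k , c₁ | e₂<k , c₂ with next-injective (not b) e₁<k c₁ e₂<k c₂ foundᵢ foundⱼ
    ... | refl = chain-no-return i j i<j prevᵢ prevⱼ

    nothing-persists : ∀ {i j} → i ≤′ j → chain i ≡ nothing → chain j ≡ nothing
    nothing-persists ≤′-refl        stopped = stopped
    nothing-persists (≤′-step i≤′j) stopped = cong advance (nothing-persists i≤′j stopped)

    chain-prefix : ∀ {i j w} → i ≤ j → chain j ≡ just w → Σ (Bool × Fin N) λ w' → chain i ≡ just w'
    chain-prefix {i} i≤j eq with chain i in eqᵢ
    ... | just w' = w' , refl
    ... | nothing with trans (sym eq) (nothing-persists (≤⇒≤′ i≤j) eqᵢ)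
    ...   | ()

    chain-terminates : chain N ≡ nothing
    chain-terminates with chain N in eq
    ... | nothing = refl
    ... | just _ =
      let i , j , i<j , same-edge = pigeonhole (n<1+n N) edgeAt
          (bᵢ , eᵢ) , eqᵢ = chain-prefix (≤-pred (toℕ<n i)) eq
          (bⱼ , eⱼ) , eqⱼ = chain-prefix (≤-pred (toℕ<n j)) eq
          eᵢ≡eⱼ = trans (sym (cong edgeOf eqᵢ)) (trans same-edge (cong edgeOf eqⱼ))
          bᵢ≡bⱼ = colour-injective (trans (sym (proj₂ (chain-coloured (toℕ i) eqᵢ)))
                                   (trans (cong c eᵢ≡eⱼ) (proj₂ (chain-coloured (toℕ j) eqⱼ))))
      in ⊥-elim (chain-no-return (toℕ i) (toℕ j) i<j eqᵢ (trans eqⱼ (cong just (sym (cong₂ _,_ bᵢ≡bⱼ eᵢ≡eⱼ)))))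
      where
      edgeOf : Maybe (Bool × Fin N) → Fin N
      edgeOf = fromMaybe e₀ ∘ Maybe.map proj₂
      edgeAt : Fin (suc N) → Fin N
      edgeAt i = edgeOf (chain (toℕ i))

    chain-bound : ∀ i {w} → chain i ≡ just w → i < N
    chain-bound i eq with i <? N
    ... | yes i<N = i<N
    ... | no  i≮N with chain-prefix (≮⇒≥ i≮N) eq
    ...   | _ , eqN with trans (sym eqN) chain-terminates
    ...     | ()

    InChain : Fin N → Set
    InChain e = Σ (Fin N) λ i → Σ Bool λ b → chain (toℕ i) ≡ just (b , e)

    inChain? : ∀ e → Dec (InChain e)
    inChain? e = any? (λ i → tagged? (chain (toℕ i)))
      where
      tagged? : (m : Maybe (Bool × Fin N)) → Dec (Σ Bool λ b → m ≡ just (b , e))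
      tagged? nothing = no λ ()
      tagged? (just (b , e')) with e' ≟ e
      ... | yes refl = yes (b , refl)
      ... | no  e'≢e = no λ { (_ , refl) → e'≢e refl }

    inChain : ∀ i {b e} → chain i ≡ just (b , e) → InChain e
    inChain i {b} {e} eq =
      fromℕ< (chain-bound i eq) , b , subst (λ j → chain j ≡ just (b , e)) (sym (toℕ-fromℕ< (chain-bound i eq))) eq

    successorA : ∀ i {e e'} → chain i ≡ just (true , e) → toℕ e' < k → eA e ≡ eA e' → c e' ≡ β → InChain e'
    successorA i {e} {e'} eq e'<k same-end colour≡ =
      inChain (suc i) (trans (cong advance eq) (cong (Maybe.map (false ,_)) found))
      where
      found : find eA (eA e) β ≡ just e'
      found = subst₂ (λ v γ → find eA v γ ≡ just e') (sym same-end) colour≡ (find-complete properA e'<k)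

    successorB : ∀ i {e e'} → chain i ≡ just (false , e) → toℕ e' < k → eB e ≡ eB e' → c e' ≡ α → InChain e'
    successorB i {e} {e'} eq e'<k same-end colour≡ =
      inChain (suc i) (trans (cong advance eq) (cong (Maybe.map (true ,_)) found))
      where
      found : find eB (eB e) α ≡ just e'
      found = subst₂ (λ v γ → find eB v γ ≡ just e') (sym same-end) colour≡ (find-complete properB e'<k)

    predecessorA : ∀ i {e} → chain i ≡ just (false , e) →
                   Σ (Fin N) λ e₁ → InChain e₁ × toℕ e₁ < k × eA e₁ ≡ eA e × c e₁ ≡ α
    predecessorA (suc i) eq =
      let e₁ , prev , found = advance-inverse (chain i) eq
          e₁<k , e₁-colour = chain-coloured i prev
      in e₁ , inChain i prev , e₁<k , sym (find-at eA _ β found) , e₁-colour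

    predecessorB : ∀ i {e} → chain i ≡ just (true , e) →
                   eB e ≡ vB ⊎ Σ (Fin N) λ e₁ → InChain e₁ × toℕ e₁ < k × eB e₁ ≡ eB e × c e₁ ≡ β
    predecessorB zero    refl = inj₁ e₀-at
    predecessorB (suc i) eq   =
      let e₁ , prev , found = advance-inverse (chain i) eq
          e₁<k , e₁-colour = chain-coloured i prev
      in inj₂ (e₁ , inChain i prev , e₁<k , sym (find-at eB _ α found) , e₁-colour)

    σ : Fin r → Fin r
    σ γ = transpose α β ⟨$⟩ʳ γ

    σ-injective : Injective _≡_ _≡_ σ
    σ-injective eq = trans (sym (inverseˡ π)) (trans (cong (π ⟨$⟩ˡ_) eq) (inverseˡ π))
      where π = transpose α β

    σ-colour : ∀ b → σ (colour b) ≡ colour (not b)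
    σ-colour true  rewrite dec-true (α ≟ α) refl = refl
    σ-colour false rewrite dec-false (β ≟ α) (α≢β ∘ sym) | dec-true (β ≟ β) refl = refl

    ClosedAt : (Fin N → V) → Set
    ClosedAt end = ∀ {e e'} → InChain e → toℕ e' < k → ¬ InChain e' → end e ≡ end e' → σ (c e) ≡ c e' → ⊥

    swap-partner : ∀ i {b e e'} → chain i ≡ just (b , e) → σ (c e) ≡ c e' → c e' ≡ colour (not b)
    swap-partner i {b} eq σ≡ = trans (sym σ≡) (trans (cong σ (proj₂ (chain-coloured i eq))) (σ-colour b))

    closedA : ClosedAt eA
    closedA (i , true , eq) e'<k e'∉ same-end σ≡ =
      e'∉ (successorA (toℕ i) eq e'<k same-end (swap-partner (toℕ i) eq σ≡))
    closedA (i , false , eq) e'<k e'∉ same-end σ≡ =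
      let e₁ , e₁∈ , e₁<k , e₁-at , e₁-colour = predecessorA (toℕ i) eq
      in e'∉ (subst InChain (properA e₁<k e'<k (trans e₁-at same-end)
                                     (trans e₁-colour (sym (swap-partner (toℕ i) eq σ≡)))) e₁∈)

    closedB : ClosedAt eB
    closedB (i , false , eq) e'<k e'∉ same-end σ≡ =
      e'∉ (successorB (toℕ i) eq e'<k same-end (swap-partner (toℕ i) eq σ≡))
    closedB (i , true , eq) e'<k e'∉ same-end σ≡ with predecessorB (toℕ i) eq
    ... | inj₁ at-vB = β-missing e'<k (trans (sym same-end) at-vB) (swap-partner (toℕ i) eq σ≡)
    ... | inj₂ (e₁ , e₁∈ , e₁<k , e₁-at , e₁-colour) =
      e'∉ (subst InChain (properB e₁<k e'<k (trans e₁-at same-end)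
                                  (trans e₁-colour (sym (swap-partner (toℕ i) eq σ≡)))) e₁∈)

    swapped : Fin N → Fin r
    swapped e with inChain? e
    ... | yes _ = σ (c e)
    ... | no  _ = c e

    swapped-cases : ∀ e → (InChain e × swapped e ≡ σ (c e)) ⊎ (¬ InChain e × swapped e ≡ c e)
    swapped-cases e with inChain? e
    ... | yes e∈ = inj₁ (e∈ , refl)
    ... | no  e∉ = inj₂ (e∉ , refl)

    swapped-proper : ∀ {end} → ProperBelow k end c → ClosedAt end → ProperBelow k end swapped
    swapped-proper proper closed {e} {e'} e<k e'<k same-end same-colour with swapped-cases e | swapped-cases e'
    ... | inj₁ (_ , s) | inj₁ (_ , s') = proper e<k e'<k same-end (σ-injective (trans (sym s) (trans same-colour s')))
    ... | inj₁ (e∈ , s) | inj₂ (e'∉ , s') =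
      ⊥-elim (closed e∈ e'<k e'∉ same-end (trans (sym s) (trans same-colour s')))
    ... | inj₂ (e∉ , s) | inj₁ (e'∈ , s') =
      ⊥-elim (closed e'∈ e<k e∉ (sym same-end) (trans (sym s') (trans (sym same-colour) s)))
    ... | inj₂ (_ , s) | inj₂ (_ , s') = proper e<k e'<k same-end (trans (sym s) (trans same-colour s'))

    α-missing-at-vA : Missing k eA swapped vA α
    α-missing-at-vA {e} e<k at-vA swapped≡α with swapped-cases e
    ... | inj₂ (_ , s) = α-missing e<k at-vA (trans (sym s) swapped≡α)
    ... | inj₁ ((i , true , eq) , s) =
      α≢β (trans (sym swapped≡α) (trans s (trans (cong σ (proj₂ (chain-coloured (toℕ i) eq))) (σ-colour true))))
    ... | inj₁ ((i , false , eq) , _) =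
      let _ , _ , e₁<k , e₁-at , e₁-colour = predecessorA (toℕ i) eq
      in α-missing e₁<k (trans e₁-at at-vA) e₁-colour

    α-missing-at-vB : Missing k eB swapped vB α
    α-missing-at-vB {e} e<k at-vB swapped≡α with swapped-cases e
    ... | inj₁ (_ , s) = β-missing e<k at-vB (σ-injective (trans (sym s) (trans swapped≡α (sym (σ-colour false)))))
    ... | inj₂ (e∉ , s) =
      let e₀≡e = properB e₀<k e<k (trans e₀-at (sym at-vB)) (trans e₀-colour (sym (trans (sym s) swapped≡α)))
      in e∉ (subst InChain e₀≡e (inChain zero refl))

  extend : ∀ {eA eB c} → AtMost r eA → AtMost r eB → ∀ ek →
           ProperBelow (toℕ ek) eA c → ProperBelow (toℕ ek) eB c →
           Σ (Fin N → Fin r) λ c' → ProperBelow (suc (toℕ ek)) eA c' × ProperBelow (suc (toℕ ek)) eB c'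
  extend {eA} {eB} {c} atMostA atMostB ek properA properB
    with missing-colour atMostA properA ek refl | missing-colour atMostB properB ek refl
  ... | α , α-missing | β , β-missing with present? (toℕ ek) eB c (eB ek) α
  ... | no ∄e = c [ ek ≔ α ] , assign-proper ek properA α-missing
                             , assign-proper ek properB (λ e<k at same-colour → ∄e (_ , e<k , at , same-colour))
  ... | yes α-present = swapped [ ek ≔ α ] , assign-proper ek (swapped-proper properA closedA) α-missing-at-vA
                                           , assign-proper ek (swapped-proper properB closedB) α-missing-at-vB
    where open KempeChain properA properB α-missing β-missing α-present

  edge-colouring : ∀ {eA eB} → AtMost r eA → AtMost r eB →
                   Σ (Fin N → Fin r) λ c → ProperAt eA c × ProperAt eB c
  edge-colouring {eA} {eB} atMostA atMostB =
    let c , properA , properB = colouring N ≤-refl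
    in c , properA (toℕ<n _) (toℕ<n _) , properB (toℕ<n _) (toℕ<n _)
    where
    colouring : ∀ k → k ≤ N → Σ (Fin N → Fin r) λ c → ProperBelow k eA c × ProperBelow k eB c
    colouring zero    _   = some-colour {end = eA} atMostA , (λ ()) , (λ ())
    colouring (suc k) k<N =
      let c , properA , properB = colouring k (≤-trans (n≤1+n k) k<N)
          k≡ = toℕ-fromℕ< k<N
          c' , properA' , properB' = extend atMostA atMostB (fromℕ< k<N)
                                       (subst (λ j → ProperBelow j eA c) (sym k≡) properA)
                                       (subst (λ j → ProperBelow j eB c) (sym k≡) properB)
      in c' , subst (λ j → ProperBelow (suc j) eA c') k≡ properA'
            , subst (λ j → ProperBelow (suc j) eB c') k≡ properB'

-- Double stars

data DSVertex (a b : ℕ) : Set where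
  centre₁ centre₂ : DSVertex a b
  leaf₁ : Fin a → DSVertex a b
  leaf₂ : Fin b → DSVertex a b

-- Its edges, oriented from the part {centre₁, leaf₂ _} of the bipartition.
data DSEdge {a b : ℕ} : DSVertex a b → DSVertex a b → Set where
  central : DSEdge centre₁ centre₂
  spoke₁  : (t : Fin a) → DSEdge centre₁ (leaf₁ t)
  spoke₂  : (t : Fin b) → DSEdge (leaf₂ t) centre₂

_~_ : ∀ {a b} → DSVertex a b → DSVertex a b → Set
ρ ~ ρ' = DSEdge ρ ρ' ⊎ DSEdge ρ' ρ

DSEdgeIn : ∀ {a b n} → (DSVertex a b → Fin n) → Fin n → Fin n → Set
DSEdgeIn {a} {b} φ x y = Σ (DSVertex a b) λ ρ → Σ (DSVertex a b) λ ρ' → ρ ~ ρ' × φ ρ ≡ x × φ ρ' ≡ y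

DSDecomposes : ∀ {n} → ℕ → ℕ → SimpleGraph n → Set
DSDecomposes {n} a b G = Σ ℕ λ k → Σ (Fin k → DSVertex a b → Fin n) λ φ →
  (∀ i → Injective _≡_ _≡_ (φ i)) ×
  (∀ i {ρ ρ'} → ρ ~ ρ' → Adj G (φ i ρ) (φ i ρ')) ×
  (∀ x y → Adj G x y → Σ (Fin k) λ i → DSEdgeIn (φ i) x y × (∀ j → DSEdgeIn (φ j) x y → j ≡ i))

module DoubleStarShape {m} (H : SimpleGraph m) (connected : Connected H) (u v : Fin m) (u≢v : u ≢ v)
                       (pendant-outside : ∀ w → ¬ Pendant H w → w ≡ u ⊎ w ≡ v) where

  pendant : ∀ {w} → w ≢ u → w ≢ v → count (adj H w) ≡ 1
  pendant {w} w≢u w≢v with degree H w ℕ.≟ 1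
  ... | yes deg≡1 = trans (sym (degree≡count H w)) deg≡1
  ... | no  deg≢1 with pendant-outside w deg≢1
  ...   | inj₁ w≡u = ⊥-elim (w≢u w≡u)
  ...   | inj₂ w≡v = ⊥-elim (w≢v w≡v)

  only-neighbour : ∀ {w x y} → w ≢ u → w ≢ v → Adj H w x → Adj H w y → x ≡ y
  only-neighbour w≢u w≢v = count≡1⇒unique (adj H _) (pendant w≢u w≢v)

  -- Otherwise u and its neighbours, which are all pendant, would form a component of H.
  centres-adjacent : Adj H u v
  centres-adjacent with adj H u v in uv
  ... | true  = refl
  ... | false with closed-under-walks S closed (connected u v) (inj₁ refl)
    where
    S : Fin m → Set
    S z = z ≡ u ⊎ Adj H u z
    closed : ∀ {z z'} → Adj H z z' → S z → S z'
    closed zz' (inj₁ refl) = inj₂ zz'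
    closed zz' (inj₂ uz)   = inj₁ (only-neighbour z≢u z≢v zz' (adj-sym H uz))
      where
      z≢u : _ ≢ u
      z≢u refl = adj-irrefl H uz
      z≢v : _ ≢ v
      z≢v refl = true≢false (trans (sym uz) uv)
  ...   | inj₁ v≡u = ⊥-elim (u≢v (sym v≡u))
  ...   | inj₂ uv' = ⊥-elim (true≢false (trans (sym uv') uv))

  otherNeighbour : Fin m → Fin m → Fin m → Bool
  otherNeighbour x y w = adj H x w ∧ not (does (w ≟ y))

  otherNeighbour-sound : ∀ {x y w} → otherNeighbour x y w ≡ true → Adj H x w × w ≢ y
  otherNeighbour-sound {x} {y} {w} other with adj H x w | w ≟ y | other
  ... | true | no w≢y | _ = refl , w≢y

  otherNeighbour-complete : ∀ {x y w} → Adj H x w → w ≢ y → otherNeighbour x y w ≡ true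
  otherNeighbour-complete {x} {y} {w} xw w≢y rewrite xw | dec-false (w ≟ y) w≢y = refl

  isLeaf₁ isLeaf₂ : Fin m → Bool
  isLeaf₁ = otherNeighbour u v
  isLeaf₂ = otherNeighbour v u

  a b : ℕ
  a = count isLeaf₁
  b = count isLeaf₂

  module Leaves₁ = Enumeration isLeaf₁
  module Leaves₂ = Enumeration isLeaf₂

  vertex : DSVertex a b → Fin m
  vertex centre₁   = u
  vertex centre₂   = v
  vertex (leaf₁ t) = Leaves₁.element t
  vertex (leaf₂ t) = Leaves₂.element t

  leaf₁-adj : ∀ t → Adj H u (vertex (leaf₁ t))
  leaf₁-adj t = proj₁ (otherNeighbour-sound (Leaves₁.element-sat t))

  leaf₂-adj : ∀ t → Adj H v (vertex (leaf₂ t))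
  leaf₂-adj t = proj₁ (otherNeighbour-sound (Leaves₂.element-sat t))

  leaf₁≢u : ∀ t → vertex (leaf₁ t) ≢ u
  leaf₁≢u t eq = adj-irrefl H (subst (Adj H u) eq (leaf₁-adj t))

  leaf₁≢v : ∀ t → vertex (leaf₁ t) ≢ v
  leaf₁≢v t = proj₂ (otherNeighbour-sound (Leaves₁.element-sat t))

  leaf₂≢u : ∀ t → vertex (leaf₂ t) ≢ u
  leaf₂≢u t = proj₂ (otherNeighbour-sound (Leaves₂.element-sat t))

  leaf₂≢v : ∀ t → vertex (leaf₂ t) ≢ v
  leaf₂≢v t eq = adj-irrefl H (subst (Adj H v) eq (leaf₂-adj t))

  leaf₁-neighbour : ∀ t {w} → Adj H (vertex (leaf₁ t)) w → w ≡ u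
  leaf₁-neighbour t adj = only-neighbour (leaf₁≢u t) (leaf₁≢v t) adj (adj-sym H (leaf₁-adj t))

  leaf₂-neighbour : ∀ t {w} → Adj H (vertex (leaf₂ t)) w → w ≡ v
  leaf₂-neighbour t adj = only-neighbour (leaf₂≢u t) (leaf₂≢v t) adj (adj-sym H (leaf₂-adj t))

  vertex-injective : Injective _≡_ _≡_ vertex
  vertex-injective {centre₁} {centre₁}  _  = refl
  vertex-injective {centre₁} {centre₂}  eq = ⊥-elim (u≢v eq)
  vertex-injective {centre₁} {leaf₁ t}  eq = ⊥-elim (leaf₁≢u t (sym eq))
  vertex-injective {centre₁} {leaf₂ t}  eq = ⊥-elim (leaf₂≢u t (sym eq))
  vertex-injective {centre₂} {centre₁}  eq = ⊥-elim (u≢v (sym eq))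
  vertex-injective {centre₂} {centre₂}  _  = refl
  vertex-injective {centre₂} {leaf₁ t}  eq = ⊥-elim (leaf₁≢v t (sym eq))
  vertex-injective {centre₂} {leaf₂ t}  eq = ⊥-elim (leaf₂≢v t (sym eq))
  vertex-injective {leaf₁ t} {centre₁}  eq = ⊥-elim (leaf₁≢u t eq)
  vertex-injective {leaf₁ t} {centre₂}  eq = ⊥-elim (leaf₁≢v t eq)
  vertex-injective {leaf₁ t} {leaf₁ t'} eq = cong leaf₁ (Leaves₁.element-injective eq)
  vertex-injective {leaf₁ t} {leaf₂ t'} eq =
    ⊥-elim (u≢v (leaf₂-neighbour t' (subst (λ x → Adj H x u) eq (adj-sym H (leaf₁-adj t)))))
  vertex-injective {leaf₂ t} {centre₁}  eq = ⊥-elim (leaf₂≢u t eq)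
  vertex-injective {leaf₂ t} {centre₂}  eq = ⊥-elim (leaf₂≢v t eq)
  vertex-injective {leaf₂ t} {leaf₁ t'} eq =
    ⊥-elim (u≢v (leaf₂-neighbour t (subst (λ x → Adj H x u) (sym eq) (adj-sym H (leaf₁-adj t')))))
  vertex-injective {leaf₂ t} {leaf₂ t'} eq = cong leaf₂ (Leaves₂.element-injective eq)

  vertex-surjective : ∀ w → Σ (DSVertex a b) λ ρ → vertex ρ ≡ w
  vertex-surjective w with w ≟ u | w ≟ v
  ... | yes refl | _        = centre₁ , refl
  ... | no _     | yes refl = centre₂ , refl
  ... | no w≢u   | no w≢v   =
    let z , wz , _ = rank-surjective (adj H w) 0 (subst (0 <_) (sym (pendant w≢u w≢v)) (s≤s z≤n))
    in attach z wz
    where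
    attach : ∀ z → Adj H w z → Σ (DSVertex a b) λ ρ → vertex ρ ≡ w
    attach z wz with z ≟ u | z ≟ v
    ... | yes refl | _        =
      let l = otherNeighbour-complete (adj-sym H wz) w≢v in leaf₁ (Leaves₁.index l) , Leaves₁.element-index l
    ... | no _     | yes refl =
      let l = otherNeighbour-complete (adj-sym H wz) w≢u in leaf₂ (Leaves₂.index l) , Leaves₂.element-index l
    -- Two adjacent pendant vertices form a component of H.
    ... | no z≢u   | no z≢v with closed-under-walks S closed (connected w u) (inj₁ refl)
      where
      S : Fin m → Set
      S t = t ≡ w ⊎ t ≡ z
      closed : ∀ {t t'} → Adj H t t' → S t → S t'
      closed tt' (inj₁ refl) = inj₂ (only-neighbour w≢u w≢v tt' wz)
      closed tt' (inj₂ refl) = inj₁ (only-neighbour z≢u z≢v tt' (adj-sym H wz))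
    ...   | inj₁ u≡w = ⊥-elim (w≢u (sym u≡w))
    ...   | inj₂ u≡z = ⊥-elim (z≢u (sym u≡z))

  role : Fin m → DSVertex a b
  role w = proj₁ (vertex-surjective w)

  vertex-role : ∀ w → vertex (role w) ≡ w
  vertex-role w = proj₂ (vertex-surjective w)

  edge⇒adjacent : ∀ {ρ ρ'} → DSEdge ρ ρ' → Adj H (vertex ρ) (vertex ρ')
  edge⇒adjacent central    = centres-adjacent
  edge⇒adjacent (spoke₁ t) = leaf₁-adj t
  edge⇒adjacent (spoke₂ t) = adj-sym H (leaf₂-adj t)

  adjacent⇒edge : ∀ ρ ρ' → Adj H (vertex ρ) (vertex ρ') → ρ ~ ρ'
  adjacent⇒edge centre₁   centre₁    adj = ⊥-elim (adj-irrefl H adj)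
  adjacent⇒edge centre₁   centre₂    _   = inj₁ central
  adjacent⇒edge centre₁   (leaf₁ t)  _   = inj₁ (spoke₁ t)
  adjacent⇒edge centre₁   (leaf₂ t)  adj = ⊥-elim (u≢v (leaf₂-neighbour t (adj-sym H adj)))
  adjacent⇒edge centre₂   centre₁    _   = inj₂ central
  adjacent⇒edge centre₂   centre₂    adj = ⊥-elim (adj-irrefl H adj)
  adjacent⇒edge centre₂   (leaf₁ t)  adj = ⊥-elim (u≢v (sym (leaf₁-neighbour t (adj-sym H adj))))
  adjacent⇒edge centre₂   (leaf₂ t)  _   = inj₂ (spoke₂ t)
  adjacent⇒edge (leaf₁ t) centre₁    _   = inj₂ (spoke₁ t)
  adjacent⇒edge (leaf₁ t) centre₂    adj = ⊥-elim (u≢v (sym (leaf₁-neighbour t adj)))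
  adjacent⇒edge (leaf₁ t) (leaf₁ t') adj = ⊥-elim (leaf₁≢u t' (leaf₁-neighbour t adj))
  adjacent⇒edge (leaf₁ t) (leaf₂ t') adj = ⊥-elim (leaf₂≢u t' (leaf₁-neighbour t adj))
  adjacent⇒edge (leaf₂ t) centre₁    adj = ⊥-elim (u≢v (leaf₂-neighbour t adj))
  adjacent⇒edge (leaf₂ t) centre₂    _   = inj₁ (spoke₂ t)
  adjacent⇒edge (leaf₂ t) (leaf₁ t') adj = ⊥-elim (leaf₁≢v t' (leaf₂-neighbour t adj))
  adjacent⇒edge (leaf₂ t) (leaf₂ t') adj = ⊥-elim (leaf₂≢v t' (leaf₂-neighbour t adj))

  count-neighbours : ∀ {x y} → Adj H x y → count (adj H x) ≡ suc (count (otherNeighbour x y))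
  count-neighbours {x} {y} xy = begin
    count (adj H x)
      ≡⟨ sum-cong-≗ split ⟩
    sum (λ w → 𝟙 (otherNeighbour x y w) + pointMass y 1 w)
      ≡⟨ ∑-distrib-+ (𝟙 ∘ otherNeighbour x y) (pointMass y 1) ⟩
    count (otherNeighbour x y) + sum (pointMass y 1)
      ≡⟨ cong (count (otherNeighbour x y) +_) (sum-pointMass y 1) ⟩
    count (otherNeighbour x y) + 1
      ≡⟨ +-comm (count (otherNeighbour x y)) 1 ⟩
    suc (count (otherNeighbour x y)) ∎
    where
    open ≡-Reasoning
    split : ∀ w → 𝟙 (adj H x w) ≡ 𝟙 (otherNeighbour x y w) + pointMass y 1 w
    split w with w ≟ y
    ... | yes refl rewrite xy = refl
    ... | no  _ with adj H x w
    ...   | true  = refl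
    ...   | false = refl

  private
    contribution : Fin m → ℕ
    contribution x = (𝟙 (adj H x u) + 𝟙 (adj H x v)) + (pointMass u a x + pointMass v b x)

  degree-by-role : ∀ ρ → count (adj H (vertex ρ)) ≡ contribution (vertex ρ)
  degree-by-role centre₁
    rewrite SimpleGraph.irrefl H u | centres-adjacent | dec-true (u ≟ u) refl | dec-false (u ≟ v) u≢v
    = trans (count-neighbours centres-adjacent) (cong suc (sym (+-identityʳ a)))
  degree-by-role centre₂
    rewrite adj-sym H centres-adjacent | SimpleGraph.irrefl H v | dec-false (v ≟ u) (u≢v ∘ sym) | dec-true (v ≟ v) refl
    = count-neighbours (adj-sym H centres-adjacent)
  degree-by-role (leaf₁ t)
    rewrite adj-sym H (leaf₁-adj t) | ¬-not (λ xv → u≢v (sym (leaf₁-neighbour t xv)))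
          | dec-false (vertex (leaf₁ t) ≟ u) (leaf₁≢u t) | dec-false (vertex (leaf₁ t) ≟ v) (leaf₁≢v t)
    = pendant (leaf₁≢u t) (leaf₁≢v t)
  degree-by-role (leaf₂ t)
    rewrite adj-sym H (leaf₂-adj t) | ¬-not (λ xu → u≢v (leaf₂-neighbour t xu))
          | dec-false (vertex (leaf₂ t) ≟ u) (leaf₂≢u t) | dec-false (vertex (leaf₂ t) ≟ v) (leaf₂≢v t)
    = pendant (leaf₂≢u t) (leaf₂≢v t)

  degree-sum : sum (degree H) ≡ 2 * suc (a + b)
  degree-sum = begin
    sum (degree H)
      ≡⟨ sum-cong-≗ (λ x → trans (degree≡count H x)
                            (subst (λ w → count (adj H w) ≡ contribution w) (vertex-role x) (degree-by-role (role x)))) ⟩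
    sum contribution
      ≡⟨ ∑-distrib-+ (λ x → 𝟙 (adj H x u) + 𝟙 (adj H x v)) (λ x → pointMass u a x + pointMass v b x) ⟩
    sum (λ x → 𝟙 (adj H x u) + 𝟙 (adj H x v)) + sum (λ x → pointMass u a x + pointMass v b x)
      ≡⟨ cong₂ _+_ (∑-distrib-+ (λ x → 𝟙 (adj H x u)) (λ x → 𝟙 (adj H x v)))
                   (∑-distrib-+ (pointMass u a) (pointMass v b)) ⟩
    (sum (λ x → 𝟙 (adj H x u)) + sum (λ x → 𝟙 (adj H x v))) + (sum (pointMass u a) + sum (pointMass v b))
      ≡⟨ cong₂ _+_ (cong₂ _+_ (degree-of u centres-adjacent) (degree-of v (adj-sym H centres-adjacent)))
                   (cong₂ _+_ (sum-pointMass u a) (sum-pointMass v b)) ⟩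
    (suc a + suc b) + (a + b)
      ≡⟨ double-count a b ⟩
    2 * suc (a + b) ∎
    where
    open ≡-Reasoning
    double-count : ∀ a b → (suc a + suc b) + (a + b) ≡ 2 * suc (a + b)
    double-count = solve-∀
    degree-of : ∀ x {y} → Adj H x y → sum (λ w → 𝟙 (adj H w x)) ≡ suc (count (otherNeighbour x y))
    degree-of x xy = trans (sum-cong-≗ (λ w → cong 𝟙 (SimpleGraph.sym H w x))) (count-neighbours xy)

  size≡ : size H ≡ suc (a + b)
  size≡ = *-cancelˡ-≡ (size H) (suc (a + b)) 2 (trans (size-handshake H) degree-sum)

  role-vertex : ∀ ρ → role (vertex ρ) ≡ ρ
  role-vertex ρ = vertex-injective (vertex-role (vertex ρ))

  ~⇒adjacent : ∀ {ρ ρ'} → ρ ~ ρ' → Adj H (vertex ρ) (vertex ρ')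
  ~⇒adjacent (inj₁ ε) = edge⇒adjacent ε
  ~⇒adjacent (inj₂ ε) = adj-sym H (edge⇒adjacent ε)

  adjacent⇒~ : ∀ {w w'} → Adj H w w' → role w ~ role w'
  adjacent⇒~ {w} {w'} ww' =
    adjacent⇒edge (role w) (role w') (subst₂ (Adj H) (sym (vertex-role w)) (sym (vertex-role w')) ww')

  decomposes : ∀ {n} {G : SimpleGraph n} → DSDecomposes a b G → Decomposes H G
  decomposes {G = G} (k , φ , φ-injective , φ-adjacent , φ-cover) =
    k , (λ i → φ i ∘ role) , injective , (λ i _ _ → φ-adjacent i ∘ adjacent⇒~) , cover
    where
    injective : ∀ i → Injective _≡_ _≡_ (φ i ∘ role)
    injective i eq = trans (sym (vertex-role _)) (trans (cong vertex (φ-injective i eq)) (vertex-role _))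
    lift : ∀ {i x y} → DSEdgeIn (φ i) x y → EdgeIn H (φ i ∘ role) x y
    lift {i} (ρ , ρ' , ρ~ρ' , at-x , at-y) =
      vertex ρ , vertex ρ' , ~⇒adjacent ρ~ρ' ,
      trans (cong (φ i) (role-vertex ρ)) at-x , trans (cong (φ i) (role-vertex ρ')) at-y
    lower : ∀ {i x y} → EdgeIn H (φ i ∘ role) x y → DSEdgeIn (φ i) x y
    lower (w , w' , ww' , at-x , at-y) = role w , role w' , adjacent⇒~ ww' , at-x , at-y
    cover : ∀ x y → Adj G x y →
            Σ (Fin k) λ i → EdgeIn H (φ i ∘ role) x y × (∀ j → EdgeIn H (φ j ∘ role) x y → j ≡ i)
    cover x y xy =
      let i , inside , unique = φ-cover x y xy
      in i , lift inside , λ j → unique j ∘ lower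

-- Splitting G

module StandardDecomposition {n} (G : SimpleGraph n) (col : Fin n → Bool)
                    (bipartite : ∀ x y → Adj G x y → col x ≢ col y)
                    (a b : ℕ) (r∣degree : ∀ x → suc (a + b) ∣ degree G x) where

  r : ℕ
  r = suc (a + b)

  ∧-true : ∀ {p q} → p ∧ q ≡ true → p ≡ true × q ≡ true
  ∧-true {true} {true} _ = refl , refl

  -- Every edge of G is an arc from its endpoint coloured true to the one coloured false.
  pair : Fin (n * n) → Fin n × Fin n
  pair = remQuot {n} n

  isArcPair : Fin n × Fin n → Bool
  isArcPair (x , y) = adj G x y ∧ col x

  isArc : Fin (n * n) → Bool
  isArc p = isArcPair (pair p)

  module Arcs = Enumeration isArc

  K : ℕ
  K = count isArc

  src dst : Fin K → Fin n
  src k = proj₁ (pair (Arcs.element k))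
  dst k = proj₂ (pair (Arcs.element k))

  arc-adjacent : ∀ k → Adj G (src k) (dst k)
  arc-adjacent k = proj₁ (∧-true (Arcs.element-sat k))

  src-colour : ∀ k → col (src k) ≡ true
  src-colour k = proj₂ (∧-true (Arcs.element-sat k))

  dst-colour : ∀ k → col (dst k) ≡ false
  dst-colour k = ¬-not λ dst-true → bipartite _ _ (arc-adjacent k) (trans (src-colour k) (sym dst-true))

  arc-injective : ∀ {k l} → src k ≡ src l → dst k ≡ dst l → k ≡ l
  arc-injective {k} {l} same-src same-dst = Arcs.element-injective (begin
    Arcs.element k                  ≡⟨ sym (combine-remQuot {n} n (Arcs.element k)) ⟩
    combine {n} {n} (src k) (dst k) ≡⟨ cong₂ combine same-src same-dst ⟩
    combine (src l) (dst l)         ≡⟨ combine-remQuot {n} n (Arcs.element l) ⟩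
    Arcs.element l                  ∎)
    where open ≡-Reasoning

  arc-from : ∀ {x y} → Adj G x y → col x ≡ true → Σ (Fin K) λ k → src k ≡ x × dst k ≡ y
  arc-from {x} {y} xy x-true = k , cong proj₁ ends , cong proj₂ ends
    where
    is-arc : isArc (combine x y) ≡ true
    is-arc = subst (λ p → isArcPair p ≡ true) (sym (remQuot-combine x y)) (cong₂ _∧_ xy x-true)
    k = Arcs.index is-arc
    ends : pair (Arcs.element k) ≡ (x , y)
    ends = trans (cong pair (Arcs.element-index is-arc)) (remQuot-combine x y)

  near far : Bool → Fin K → Fin n
  near true  = src
  near false = dst
  far true  = dst
  far false = src

  near-colour : ∀ s k → col (near s k) ≡ s
  near-colour true  = src-colour
  near-colour false = dst-colour

  near-far-adjacent : ∀ s k → Adj G (near s k) (far s k)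
  near-far-adjacent true  k = arc-adjacent k
  near-far-adjacent false k = adj-sym G (arc-adjacent k)

  near-far-injective : ∀ s {k l} → near s k ≡ near s l → far s k ≡ far s l → k ≡ l
  near-far-injective true  same-near same-far = arc-injective same-near same-far
  near-far-injective false same-near same-far = arc-injective same-far same-near

  arc-at : ∀ s {x w} → Adj G x w → col x ≡ s → Σ (Fin K) λ k → near s k ≡ x × far s k ≡ w
  arc-at true  xw x-true  = arc-from xw x-true
  arc-at false {x} {w} xw x-false =
    let k , src≡w , dst≡x = arc-from (adj-sym G xw) w-true in k , dst≡x , src≡w
    where
    w-true : col w ≡ true
    w-true = ¬-not λ w-false → bipartite x w xw (trans x-false (sym w-false))

  -- The neighbours of x, numbered by rank, are cut into blocks of r consecutive ones;
  -- end s k is the block at the s-coloured end of the arc k.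
  slot : Bool → Fin K → ℕ
  slot s k = rank (adj G (near s k)) (far s k)

  end : Bool → Fin K → Fin n × ℕ
  end s k = near s k , slot s k / r

  slot-injective : ∀ s {k l} → near s k ≡ near s l → slot s k ≡ slot s l → k ≡ l
  slot-injective s {k} {l} same-near same-slot =
    near-far-injective s same-near
      (rank-injective (adj G (near s k)) (near-far-adjacent s k) l-adjacent
        (trans same-slot (cong (λ x → rank (adj G x) (far s l)) (sym same-near))))
    where
    l-adjacent : Adj G (near s k) (far s l)
    l-adjacent = subst (λ x → Adj G x (far s l)) (sym same-near) (near-far-adjacent s l)

  end-atMost : ∀ s → AtMost r (end s)
  end-atMost s = atMost-byResidue (λ k → slot s k mod r) separates
    where
    separates : ∀ {k l} → end s k ≡ end s l → slot s k mod r ≡ slot s l mod r → k ≡ l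
    separates {k} {l} same-end same-residue = slot-injective s (cong proj₁ same-end) (begin
      slot s k                         ≡⟨ m≡m%n+[m/n]*n (slot s k) r ⟩
      slot s k % r + slot s k / r * r  ≡⟨ cong₂ (λ i q → i + q * r) same-remainder (cong proj₂ same-end) ⟩
      slot s l % r + slot s l / r * r  ≡⟨ sym (m≡m%n+[m/n]*n (slot s l) r) ⟩
      slot s l                         ∎)
      where
      open ≡-Reasoning
      same-remainder : slot s k % r ≡ slot s l % r
      same-remainder = trans (sym (toℕ-fromℕ< _)) (trans (cong toℕ same-residue) (toℕ-fromℕ< _))

  -- The blocks are full because r divides every degree.
  block-arcs : ∀ s k → Σ (Fin r → Fin K) λ h → Injective _≡_ _≡_ h × (∀ j → end s (h j) ≡ end s k)
  block-arcs s k = h , h-injective , h-end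
    where
    x = near s k
    β = slot s k / r
    q = _∣_.quotient (r∣degree x)
    count≡ : count (adj G x) ≡ q * r
    count≡ = trans (sym (degree≡count G x)) (_∣_.equality (r∣degree x))
    β<q : β < q
    β<q = m<n*o⇒m/o<n (subst (slot s k <_) count≡ (rank<count (adj G x) (near-far-adjacent s k)))
    target : Fin r → ℕ
    target j = toℕ j + β * r
    target<count : ∀ j → target j < count (adj G x)
    target<count j = subst (target j <_) (sym count≡) (<-≤-trans (+-monoˡ-< (β * r) (toℕ<n j)) (*-monoˡ-≤ r β<q))
    target/r : ∀ j → target j / r ≡ β
    target/r j = begin
      (toℕ j + β * r) / r   ≡⟨ +-distrib-/-∣ʳ (toℕ j) (n∣m*n β) ⟩
      toℕ j / r + β * r / r ≡⟨ cong₂ _+_ (m<n⇒m/n≡0 (toℕ<n j)) (m*n/n≡m β r) ⟩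
      β                     ∎
      where open ≡-Reasoning
    neighbour : ∀ j → Σ (Fin n) λ w → Adj G x w × rank (adj G x) w ≡ target j
    neighbour j = rank-surjective (adj G x) (target j) (target<count j)
    arc : ∀ j → Σ (Fin K) λ l → near s l ≡ x × far s l ≡ proj₁ (neighbour j)
    arc j = arc-at s (proj₁ (proj₂ (neighbour j))) (near-colour s k)
    h : Fin r → Fin K
    h j = proj₁ (arc j)
    slot≡ : ∀ j → slot s (h j) ≡ target j
    slot≡ j = trans (cong₂ (λ y z → rank (adj G y) z) (proj₁ (proj₂ (arc j))) (proj₂ (proj₂ (arc j))))
                    (proj₂ (proj₂ (neighbour j)))
    h-end : ∀ j → end s (h j) ≡ end s k
    h-end j = cong₂ _,_ (proj₁ (proj₂ (arc j))) (trans (cong (_/ r) (slot≡ j)) (target/r j))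
    h-injective : Injective _≡_ _≡_ h
    h-injective {i} {j} hi≡hj = toℕ-injective (+-cancelʳ-≡ (β * r) (toℕ i) (toℕ j)
      (trans (sym (slot≡ i)) (trans (cong (slot s) hi≡hj) (slot≡ j))))

  _≟ᵥ_ : (v w : Fin n × ℕ) → Dec (v ≡ w)
  _≟ᵥ_ = ≡-dec _≟_ ℕ._≟_

  -- Opaque: type checking must never unfold the Kempe-chain construction behind the colouring.
  opaque
    colouring : Σ (Fin K → Fin r) λ c → ProperAt (end true) c × ProperAt (end false) c
    colouring = edge-colouring _≟ᵥ_ (end-atMost true) (end-atMost false)

    c : Fin K → Fin r
    c = proj₁ colouring

    proper : ∀ s → ProperAt (end s) c
    proper true  = proj₁ (proj₂ colouring)
    proper false = proj₂ (proj₂ colouring)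

    colour-present : ∀ s k γ → Σ (Fin K) λ l → end s l ≡ end s k × c l ≡ γ
    colour-present s k = let h , h-injective , h-end = block-arcs s k in every-colour (proper s) h h-injective h-end

  blockArc : Bool → Fin K → Fin r → Fin K
  blockArc s k γ = proj₁ (colour-present s k γ)

  blockArc-end : ∀ s k γ → end s (blockArc s k γ) ≡ end s k
  blockArc-end s k γ = proj₁ (proj₂ (colour-present s k γ))

  blockArc-colour : ∀ s k γ → c (blockArc s k γ) ≡ γ
  blockArc-colour s k γ = proj₂ (proj₂ (colour-present s k γ))

  blockArc-near : ∀ s k γ → near s (blockArc s k γ) ≡ near s k
  blockArc-near s k γ = cong proj₁ (blockArc-end s k γ)

  blockArc-unique : ∀ s {k l γ} → end s l ≡ end s k → c l ≡ γ → blockArc s k γ ≡ l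
  blockArc-unique s {k} {l} {γ} same-end c≡γ =
    proper s (trans (blockArc-end s k γ) (sym same-end)) (trans (blockArc-colour s k γ) (sym c≡γ))

  blockArc-determined : ∀ s k γ {l} → near s l ≡ near s k → far s (blockArc s k γ) ≡ far s l → γ ≡ c l
  blockArc-determined s k γ same-near same-far =
    trans (sym (blockArc-colour s k γ))
          (cong c (near-far-injective s (trans (blockArc-near s k γ) (sym same-near)) same-far))

  -- Colour zero is reserved for the central edges of the copies, colour₁ t for the spoke to the
  -- t-th leaf at the first centre, and colour₂ t for the spoke to the t-th leaf at the second.
  colour₁ : Fin a → Fin r
  colour₁ t = suc (t ↑ˡ b)

  colour₂ : Fin b → Fin r
  colour₂ t = suc (a ↑ʳ t)

  data ColourView : Fin r → Set where
    central-colour : ColourView zero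
    colour₁-view   : ∀ t → ColourView (colour₁ t)
    colour₂-view   : ∀ t → ColourView (colour₂ t)

  colourView : ∀ γ → ColourView γ
  colourView zero    = central-colour
  colourView (suc γ) with splitAt a γ in split
  ... | inj₁ t = subst (ColourView ∘ suc) (trans (cong (join a b) (sym split)) (join-splitAt a b γ)) (colour₁-view t)
  ... | inj₂ t = subst (ColourView ∘ suc) (trans (cong (join a b) (sym split)) (join-splitAt a b γ)) (colour₂-view t)

  colour₁≢zero : ∀ t → colour₁ t ≢ zero
  colour₁≢zero t ()

  colour₂≢zero : ∀ t → colour₂ t ≢ zero
  colour₂≢zero t ()

  colour₁-injective : ∀ {t t'} → colour₁ t ≡ colour₁ t' → t ≡ t'
  colour₁-injective = ↑ˡ-injective b _ _ ∘ suc-injective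

  colour₂-injective : ∀ {t t'} → colour₂ t ≡ colour₂ t' → t ≡ t'
  colour₂-injective = ↑ʳ-injective a _ _ ∘ suc-injective

  -- The copy of the double star whose central edge is the arc k (used when c k ≡ zero).
  place : Fin K → DSVertex a b → Fin n
  place k centre₁   = src k
  place k centre₂   = dst k
  place k (leaf₁ t) = dst (blockArc true k (colour₁ t))
  place k (leaf₂ t) = src (blockArc false k (colour₂ t))

  spokeArc : ∀ {ρ ρ'} → Fin K → DSEdge ρ ρ' → Fin K
  spokeArc k central    = k
  spokeArc k (spoke₁ t) = blockArc true k (colour₁ t)
  spokeArc k (spoke₂ t) = blockArc false k (colour₂ t)

  spokeArc-ends : ∀ k {ρ ρ'} (ε : DSEdge ρ ρ') →
                  src (spokeArc k ε) ≡ place k ρ × dst (spokeArc k ε) ≡ place k ρ'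
  spokeArc-ends k central    = refl , refl
  spokeArc-ends k (spoke₁ t) = blockArc-near true k (colour₁ t) , refl
  spokeArc-ends k (spoke₂ t) = refl , blockArc-near false k (colour₂ t)

  centreOf : Fin K → Fin r → Fin K
  centreOf l zero    = l
  centreOf l (suc γ) with splitAt a γ
  ... | inj₁ _ = blockArc true l zero
  ... | inj₂ _ = blockArc false l zero

  centre : Fin K → Fin K
  centre l = centreOf l (c l)

  centre-colour : ∀ l → c (centre l) ≡ zero
  centre-colour l = centreOf-colour (c l) refl
    where
    centreOf-colour : ∀ γ → c l ≡ γ → c (centreOf l γ) ≡ zero
    centreOf-colour zero    c≡ = c≡
    centreOf-colour (suc γ) _ with splitAt a γ
    ... | inj₁ _ = blockArc-colour true l zero
    ... | inj₂ _ = blockArc-colour false l zero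

  centre-spokeArc : ∀ {k} → c k ≡ zero → ∀ {ρ ρ'} (ε : DSEdge ρ ρ') → centre (spokeArc k ε) ≡ k
  centre-spokeArc {k} c≡0 central rewrite c≡0 = refl
  centre-spokeArc {k} c≡0 (spoke₁ t) rewrite blockArc-colour true k (colour₁ t) | splitAt-↑ˡ a t b =
    blockArc-unique true (sym (blockArc-end true k (colour₁ t))) c≡0
  centre-spokeArc {k} c≡0 (spoke₂ t) rewrite blockArc-colour false k (colour₂ t) | splitAt-↑ʳ a b t =
    blockArc-unique false (sym (blockArc-end false k (colour₂ t))) c≡0

  IsSpoke : Fin K → Fin K → Set
  IsSpoke k l = Σ (DSVertex a b) λ ρ → Σ (DSVertex a b) λ ρ' → Σ (DSEdge ρ ρ') λ ε → spokeArc k ε ≡ l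

  centre-covers : ∀ l → IsSpoke (centre l) l
  centre-covers l = covers (c l) refl (colourView (c l))
    where
    covers : ∀ γ → c l ≡ γ → ColourView γ → IsSpoke (centreOf l γ) l
    covers _ _ central-colour = centre₁ , centre₂ , central , refl
    covers _ c≡ (colour₁-view t) rewrite splitAt-↑ˡ a t b =
      centre₁ , leaf₁ t , spoke₁ t , blockArc-unique true (sym (blockArc-end true l zero)) c≡
    covers _ c≡ (colour₂-view t) rewrite splitAt-↑ʳ a b t =
      leaf₂ t , centre₂ , spoke₂ t , blockArc-unique false (sym (blockArc-end false l zero)) c≡

  part : DSVertex a b → Bool
  part centre₁   = true
  part centre₂   = false
  part (leaf₁ _) = false
  part (leaf₂ _) = true

  place-colour : ∀ k ρ → col (place k ρ) ≡ part ρ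
  place-colour k centre₁   = src-colour k
  place-colour k centre₂   = dst-colour k
  place-colour k (leaf₁ t) = dst-colour _
  place-colour k (leaf₂ t) = src-colour _

  place-injective : ∀ {k} → c k ≡ zero → Injective _≡_ _≡_ (place k)
  place-injective {k} c≡0 {ρ} {ρ'} = go ρ ρ'
    where
    across : ∀ ρ ρ' → part ρ ≢ part ρ' → place k ρ ≢ place k ρ'
    across ρ ρ' parts-differ eq =
      parts-differ (trans (sym (place-colour k ρ)) (trans (cong col eq) (place-colour k ρ')))
    not-central : ∀ s γ → far s (blockArc s k γ) ≡ far s k → γ ≡ zero
    not-central s γ eq = trans (blockArc-determined s k γ refl eq) c≡0
    same-spoke : ∀ s γ δ → far s (blockArc s k γ) ≡ far s (blockArc s k δ) → γ ≡ δ
    same-spoke s γ δ eq = trans (blockArc-determined s k γ (blockArc-near s k δ) eq) (blockArc-colour s k δ)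
    go : ∀ ρ ρ' → place k ρ ≡ place k ρ' → ρ ≡ ρ'
    go centre₁   centre₁    _  = refl
    go centre₁   centre₂    eq = ⊥-elim (across centre₁ centre₂ (λ ()) eq)
    go centre₁   (leaf₁ t)  eq = ⊥-elim (across centre₁ (leaf₁ t) (λ ()) eq)
    go centre₁   (leaf₂ t)  eq = ⊥-elim (colour₂≢zero t (not-central false (colour₂ t) (sym eq)))
    go centre₂   centre₁    eq = ⊥-elim (across centre₂ centre₁ (λ ()) eq)
    go centre₂   centre₂    _  = refl
    go centre₂   (leaf₁ t)  eq = ⊥-elim (colour₁≢zero t (not-central true (colour₁ t) (sym eq)))
    go centre₂   (leaf₂ t)  eq = ⊥-elim (across centre₂ (leaf₂ t) (λ ()) eq)
    go (leaf₁ t) centre₁    eq = ⊥-elim (across (leaf₁ t) centre₁ (λ ()) eq)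
    go (leaf₁ t) centre₂    eq = ⊥-elim (colour₁≢zero t (not-central true (colour₁ t) eq))
    go (leaf₁ t) (leaf₁ t') eq = cong leaf₁ (colour₁-injective (same-spoke true (colour₁ t) (colour₁ t') eq))
    go (leaf₁ t) (leaf₂ t') eq = ⊥-elim (across (leaf₁ t) (leaf₂ t') (λ ()) eq)
    go (leaf₂ t) centre₁    eq = ⊥-elim (colour₂≢zero t (not-central false (colour₂ t) eq))
    go (leaf₂ t) centre₂    eq = ⊥-elim (across (leaf₂ t) centre₂ (λ ()) eq)
    go (leaf₂ t) (leaf₁ t') eq = ⊥-elim (across (leaf₂ t) (leaf₁ t') (λ ()) eq)
    go (leaf₂ t) (leaf₂ t') eq = cong leaf₂ (colour₂-injective (same-spoke false (colour₂ t) (colour₂ t') eq))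

  Joins : Fin K → Fin n → Fin n → Set
  Joins l x y = (src l ≡ x × dst l ≡ y) ⊎ (src l ≡ y × dst l ≡ x)

  arc-joining : ∀ {x y} → Adj G x y → Σ (Fin K) λ l → Joins l x y
  arc-joining {x} {y} xy with col x in x-colour
  ... | true  = let l , src≡x , dst≡y = arc-at true xy x-colour in l , inj₁ (src≡x , dst≡y)
  ... | false = let l , dst≡x , src≡y = arc-at false xy x-colour in l , inj₂ (src≡y , dst≡x)

  joins-unique : ∀ {k l x y} → Joins k x y → Joins l x y → k ≡ l
  joins-unique (inj₁ (sk , dk)) (inj₁ (sl , dl)) = arc-injective (trans sk (sym sl)) (trans dk (sym dl))
  joins-unique (inj₂ (sk , dk)) (inj₂ (sl , dl)) = arc-injective (trans sk (sym sl)) (trans dk (sym dl))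
  joins-unique {k} {l} (inj₁ (sk , _)) (inj₂ (_ , dl)) =
    ⊥-elim (true≢false (trans (sym (src-colour k)) (trans (cong col (trans sk (sym dl))) (dst-colour l))))
  joins-unique {k} {l} (inj₂ (_ , dk)) (inj₁ (sl , _)) =
    ⊥-elim (true≢false (trans (sym (src-colour l)) (trans (cong col (trans sl (sym dk))) (dst-colour k))))

  spokeArc-joins : ∀ {k x y ρ ρ'} (ε : DSEdge ρ ρ') → Joins (spokeArc k ε) x y → DSEdgeIn (place k) x y
  spokeArc-joins {k} ε (inj₁ (s≡x , d≡y)) =
    _ , _ , inj₁ ε , trans (sym (proj₁ (spokeArc-ends k ε))) s≡x , trans (sym (proj₂ (spokeArc-ends k ε))) d≡y
  spokeArc-joins {k} ε (inj₂ (s≡y , d≡x)) =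
    _ , _ , inj₂ ε , trans (sym (proj₂ (spokeArc-ends k ε))) d≡x , trans (sym (proj₁ (spokeArc-ends k ε))) s≡y

  joins-spokeArc : ∀ {k x y} → DSEdgeIn (place k) x y → Σ (DSVertex a b) λ ρ → Σ (DSVertex a b) λ ρ' →
                   Σ (DSEdge ρ ρ') λ ε → Joins (spokeArc k ε) x y
  joins-spokeArc {k} (_ , _ , inj₁ ε , at-x , at-y) =
    _ , _ , ε , inj₁ (trans (proj₁ (spokeArc-ends k ε)) at-x , trans (proj₂ (spokeArc-ends k ε)) at-y)
  joins-spokeArc {k} (_ , _ , inj₂ ε , at-x , at-y) =
    _ , _ , ε , inj₂ (trans (proj₁ (spokeArc-ends k ε)) at-y , trans (proj₂ (spokeArc-ends k ε)) at-x)

  place-adjacent : ∀ k {ρ ρ'} → ρ ~ ρ' → Adj G (place k ρ) (place k ρ')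
  place-adjacent k (inj₁ ε) = subst₂ (Adj G) (proj₁ (spokeArc-ends k ε)) (proj₂ (spokeArc-ends k ε)) (arc-adjacent _)
  place-adjacent k (inj₂ ε) =
    adj-sym G (subst₂ (Adj G) (proj₁ (spokeArc-ends k ε)) (proj₂ (spokeArc-ends k ε)) (arc-adjacent _))

  isCentral : Fin K → Bool
  isCentral k = does (c k ≟ zero)

  module Centres = Enumeration isCentral

  central-colour≡ : ∀ {k} → isCentral k ≡ true → c k ≡ zero
  central-colour≡ {k} _ with c k ≟ zero
  ... | yes c≡0 = c≡0

  decomposition : DSDecomposes a b G
  decomposition = count isCentral , copy , copy-injective , (λ i → place-adjacent (Centres.element i)) , cover
    where
    copy : Fin (count isCentral) → DSVertex a b → Fin n
    copy i = place (Centres.element i)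
    copy-injective : ∀ i → Injective _≡_ _≡_ (copy i)
    copy-injective i = place-injective (central-colour≡ (Centres.element-sat i))
    cover : ∀ x y → Adj G x y →
            Σ (Fin (count isCentral)) λ i → DSEdgeIn (copy i) x y × (∀ j → DSEdgeIn (copy j) x y → j ≡ i)
    cover x y xy = i , inside , unique
      where
      l = proj₁ (arc-joining xy)
      is-central : isCentral (centre l) ≡ true
      is-central = dec-true (c (centre l) ≟ zero) (centre-colour l)
      i = Centres.index is-central
      inside : DSEdgeIn (copy i) x y
      inside = let _ , _ , ε , spoke≡l = centre-covers l in
        subst (λ k → DSEdgeIn (place k) x y) (sym (Centres.element-index is-central))
          (spokeArc-joins ε (subst (λ l → Joins l x y) (sym spoke≡l) (proj₂ (arc-joining xy))))
      unique : ∀ j → DSEdgeIn (copy j) x y → j ≡ i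
      unique j inside-j =
        let _ , _ , ε , joins = joins-spokeArc inside-j
            k = Centres.element j
        in Centres.element≡⇒index is-central (begin
          k                        ≡⟨ sym (centre-spokeArc (central-colour≡ (Centres.element-sat j)) ε) ⟩
          centre (spokeArc k ε)    ≡⟨ cong centre (joins-unique joins (proj₂ (arc-joining xy))) ⟩
          centre l                 ∎)
        where open ≡-Reasoning

mainTheorem3 : (r : ℕ) → 3 ≤ r →
    (n : ℕ) (G : SimpleGraph n) → Bipartite G → (∀ v → r ∣ degree G v) →
    (m : ℕ) (H : SimpleGraph m) → IsDoubleStar H → size H ≡ r →
    Decomposes H G
mainTheorem3 r _ n G (col , bipartite) r∣degree m H ((connected , _) , u , v , u≢v , _ , _ , pendant-outside) size≡r =
  decomposes {G = G}
    (StandardDecomposition.decomposition G col bipartite a b (subst (λ d → ∀ x → d ∣ degree G x) r≡1+a+b r∣degree))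
  where
  open DoubleStarShape H connected u v u≢v pendant-outside
  r≡1+a+b : r ≡ suc (a + b)
  r≡1+a+b = trans (sym size≡r) size≡
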